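{- Let $G$ be a $D$-degenerate $n$-vertex graph. Then there exist an integer $0\le d\le 2D$ and a set $I\subseteq V(G)$ with $|I|\ge(2D+1)^{ -3}n$ which is independent in $G$ and all of whose vertices have degree exactly $d$ in $G$.
   Context: A graph is $D$-degenerate if there is an ordering of its vertices in which every vertex has at most $D$ neighbours preceding it. -}

module Defs where

open import Data.Nat using (ℕ; zero; suc; _+_; _*_; _^_; _≤_; _<_; _<ᵇ_)
open import Data.Bool using (Bool; true; false; if_then_else_)
open import Data.Fin using (Fin; zero; suc; toℕ)
open import Data.Fin.Subset using (Subset; _∈_)
open import Data.Product using (Σ; ∃; _×_; _,_)
open import Relation.Binary.PropositionalEquality using (_≡_)
open import Relation.Nullary using (¬_)
open import Function.Bundles using (_↔_; Inverse)
open import Function using (_∘_)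

record Graph (n : ℕ) : Set where
  field
    adj   : Fin n → Fin n → Bool
    sym   : ∀ u v → adj u v ≡ adj v u
    irrefl : ∀ v → adj v v ≡ false

open Graph public

countTrue : ∀ {n} → (Fin n → Bool) → ℕ
countTrue {zero}  f = 0
countTrue {suc n} f = (if f zero then 1 else 0) + countTrue (f ∘ suc)

degree : ∀ {n} → Graph n → Fin n → ℕ
degree G v = countTrue (adj G v)

-- D-degenerate: there is an ordering of the vertices (a bijection
-- σ : Fin n ↔ Fin n, position i holds vertex σ i) in which every vertex
-- has at most D neighbours at earlier positions.
Degenerate : ∀ {n} → ℕ → Graph n → Set
Degenerate {n} D G =
  Σ (Fin n ↔ Fin n) λ σ →
    ∀ (i : Fin n) →
      countTrue (λ j → if toℕ j <ᵇ toℕ i then adj G (Inverse.to σ j) (Inverse.to σ i) else false) ≤ D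

Independent : ∀ {n} → Graph n → Subset n → Set
Independent G I = ∀ u v → u ∈ I → v ∈ I → adj G u v ≡ false

-- A degeneracy ordering counts every edge once, at its later endpoint, so the degree sum
-- is at most 2Dn. By Markov's inequality at least n/(2D+1) vertices have degree at most 2D,
-- and by pigeonhole at least n/(2D+1)² of them share one degree d ≤ 2D. Greedily keeping one
-- of these vertices and discarding its closed neighbourhood (at most 2D+1 vertices) yields an
-- independent set containing at least a 1/(2D+1) fraction of them.

module Submission where

open import Defs hiding (sym)
open import Algebra.Properties.CommutativeSemigroup using (interchange)
open import Data.Bool using (Bool; true; false; if_then_else_; _∧_; _∨_; not; T)
open import Data.Bool.Properties using (T-≡; T-∧; T-∨; ∨-identityʳ; ¬-not)
open import Data.Empty using (⊥-elim)
open import Data.Fin using (Fin; zero; suc; toℕ)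
open import Data.Fin.Properties using (_≟_; any?; toℕ-injective)
open import Data.Fin.Subset using (Subset; _∈_; ∣_∣)
open import Data.Nat using (ℕ; zero; suc; _+_; _*_; _^_; _≤_; _<_; _<ᵇ_; _≤ᵇ_; _≡ᵇ_; z≤n; s≤s)
open import Data.Nat.Induction using (<-wellFounded)
open import Data.Nat.Properties
  using ( ≤-refl; ≤-reflexive; ≤-trans; ≤-total; ≤-antisym; +-mono-≤; *-monoʳ-≤; +-cancelˡ-≤
        ; +-comm; +-suc; +-identityʳ; *-suc; *-comm; *-distribˡ-+; *-assoc; *-identityˡ; *-identityʳ; *-zeroʳ
        ; ≤ᵇ⇒≤; ≤⇒≤ᵇ; <ᵇ⇒<; <⇒<ᵇ; ≡ᵇ⇒≡; ≡⇒≡ᵇ; ≰⇒>; ≮⇒≥; <-asym; m≤n⇒m<n∨m≡n; m<1+n⇒m≤n; m≤n⇒m≤1+n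
        ; +-*-semiring; +-commutativeSemigroup; module ≤-Reasoning )
open import Data.Nat.Tactic.RingSolver using (solve-∀)
open import Data.Product using (Σ; _×_; _,_; proj₁; proj₂)
open import Data.Sum using (inj₁; inj₂; [_,_])
open import Data.Vec using (tabulate)
open import Data.Vec.Properties using (lookup∘tabulate; []=⇒lookup)
open import Function using (_∘_; id)
open import Function.Bundles using (_↔_; Inverse; Equivalence)
open import Induction.WellFounded using (Acc; acc)
open import Relation.Nullary using (¬_; yes; no; does)
open import Relation.Nullary.Decidable.Core using (T?)
open import Relation.Nullary.Decidable using (dec-true)
open import Relation.Binary.PropositionalEquality using (_≡_; refl; sym; trans; cong; cong₂; subst; module ≡-Reasoning)
open import Algebra.Properties.Semiring.Sum +-*-semiring
  using (sum; sum-cong-≗; sum-permute; ∑-comm; ∑-distrib-+; *-distribˡ-sum)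

open Equivalence using (to; from)

boolToℕ : Bool → ℕ
boolToℕ b = if b then 1 else 0

infix 4 _⊆_
_⊆_ : ∀ {n} → (Fin n → Bool) → (Fin n → Bool) → Set
f ⊆ g = ∀ i → T (f i) → T (g i)

countTrue≡sum : ∀ {n} (f : Fin n → Bool) → countTrue f ≡ sum (boolToℕ ∘ f)
countTrue≡sum {zero}  f = refl
countTrue≡sum {suc n} f = cong (boolToℕ (f zero) +_) (countTrue≡sum (f ∘ suc))

countTrue-cong : ∀ {n} {f g : Fin n → Bool} → (∀ i → f i ≡ g i) → countTrue f ≡ countTrue g
countTrue-cong {zero}  f≗g = refl
countTrue-cong {suc n} f≗g = cong₂ _+_ (cong boolToℕ (f≗g zero)) (countTrue-cong (f≗g ∘ suc))

boolToℕ-mono : ∀ a b → (T a → T b) → boolToℕ a ≤ boolToℕ b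
boolToℕ-mono false b     a⇒b = z≤n
boolToℕ-mono true  true  a⇒b = ≤-refl
boolToℕ-mono true  false a⇒b = ⊥-elim (a⇒b _)

countTrue-mono : ∀ {n} {f g : Fin n → Bool} → f ⊆ g → countTrue f ≤ countTrue g
countTrue-mono {zero}          f⊆g = z≤n
countTrue-mono {suc n} {f} {g} f⊆g =
  +-mono-≤ (boolToℕ-mono (f zero) (g zero) (f⊆g zero)) (countTrue-mono (f⊆g ∘ suc))

boolToℕ-∨ : ∀ a b → boolToℕ (a ∨ b) ≤ boolToℕ a + boolToℕ b
boolToℕ-∨ true  b = s≤s z≤n
boolToℕ-∨ false b = ≤-refl

countTrue-∨ : ∀ {n} (f g : Fin n → Bool) → countTrue (λ i → f i ∨ g i) ≤ countTrue f + countTrue g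
countTrue-∨ {zero}  f g = z≤n
countTrue-∨ {suc n} f g = ≤-trans
  (+-mono-≤ (boolToℕ-∨ (f zero) (g zero)) (countTrue-∨ (f ∘ suc) (g ∘ suc)))
  (≤-reflexive (interchange +-commutativeSemigroup (boolToℕ (f zero)) (boolToℕ (g zero)) _ _))

countTrue-none : ∀ {n} (f : Fin n → Bool) → (∀ i → ¬ T (f i)) → countTrue f ≡ 0
countTrue-none {zero}  f none = refl
countTrue-none {suc n} f none with f zero | none zero
... | true  | ¬tt = ⊥-elim (¬tt _)
... | false | _   = countTrue-none (f ∘ suc) (none ∘ suc)

countTrue-not+countTrue : ∀ {n} (f : Fin n → Bool) → countTrue (not ∘ f) + countTrue f ≡ n
countTrue-not+countTrue {zero}  f = refl
countTrue-not+countTrue {suc n} f with f zero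
... | true  = trans (+-suc _ _) (cong suc (countTrue-not+countTrue (f ∘ suc)))
... | false = cong suc (countTrue-not+countTrue (f ∘ suc))

countTrue-insert : ∀ {n} (f : Fin n → Bool) v → ¬ T (f v) →
                   countTrue (λ i → f i ∨ does (i ≟ v)) ≡ suc (countTrue f)
countTrue-insert {suc n} f zero v∉f with f zero
... | true  = ⊥-elim (v∉f _)
... | false = cong suc (countTrue-cong (λ i → ∨-identityʳ (f (suc i))))
countTrue-insert {suc n} f (suc v) v∉f = trans
  (cong₂ _+_ (cong boolToℕ (∨-identityʳ (f zero))) (countTrue-insert (f ∘ suc) v v∉f))
  (+-suc _ _)

∣tabulate∣≡countTrue : ∀ {n} (f : Fin n → Bool) → ∣ tabulate f ∣ ≡ countTrue f
∣tabulate∣≡countTrue {zero}  f = refl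
∣tabulate∣≡countTrue {suc n} f with f zero
... | true  = cong suc (∣tabulate∣≡countTrue (f ∘ suc))
... | false = ∣tabulate∣≡countTrue (f ∘ suc)

∈tabulate⇒T : ∀ {n} (f : Fin n → Bool) {v} → v ∈ tabulate f → T (f v)
∈tabulate⇒T f {v} v∈ = from T-≡ (trans (sym (lookup∘tabulate f v)) ([]=⇒lookup v∈))

sum-mono-≤ : ∀ {n} {f g : Fin n → ℕ} → (∀ i → f i ≤ g i) → sum f ≤ sum g
sum-mono-≤ {zero}  f≤g = z≤n
sum-mono-≤ {suc n} f≤g = +-mono-≤ (f≤g zero) (sum-mono-≤ (f≤g ∘ suc))

sum≤n*c : ∀ {n} {f : Fin n → ℕ} {c} → (∀ i → f i ≤ c) → sum f ≤ n * c
sum≤n*c {zero}  f≤c = z≤n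
sum≤n*c {suc n} f≤c = +-mono-≤ (f≤c zero) (sum≤n*c (f≤c ∘ suc))

module _ {n} (G : Graph n) (σ : Fin n ↔ Fin n) where

  private
    π : Fin n → Fin n
    π = Inverse.to σ

  earlierNeighbour : Fin n → Fin n → Bool
  earlierNeighbour i j = if toℕ j <ᵇ toℕ i then adj G (π j) (π i) else false

  backDegree : Fin n → ℕ
  backDegree i = countTrue (earlierNeighbour i)

  adj≡earlier+later : ∀ i j →
    boolToℕ (adj G (π i) (π j)) ≡ boolToℕ (earlierNeighbour i j) + boolToℕ (earlierNeighbour j i)
  adj≡earlier+later i j with toℕ j <ᵇ toℕ i in j<i | toℕ i <ᵇ toℕ j in i<j
  ... | true  | true  = ⊥-elim (<-asym (<ᵇ⇒< (toℕ j) (toℕ i) (from T-≡ j<i)) (<ᵇ⇒< (toℕ i) (toℕ j) (from T-≡ i<j)))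
  ... | true  | false = trans (cong boolToℕ (Graph.sym G (π i) (π j))) (sym (+-identityʳ _))
  ... | false | true  = refl
  ... | false | false = trans (cong (λ k → boolToℕ (adj G (π k) (π j))) i≡j)
                              (cong boolToℕ (irrefl G (π j)))
    where
    i≡j : i ≡ j
    i≡j = toℕ-injective (≤-antisym (≮⇒≥ (subst T j<i ∘ <⇒<ᵇ)) (≮⇒≥ (subst T i<j ∘ <⇒<ᵇ)))

  sum-degree≡sum-backDegree+sum-backDegree : sum (degree G) ≡ sum backDegree + sum backDegree
  sum-degree≡sum-backDegree+sum-backDegree = begin
    sum (degree G)                                          ≡⟨ sum-permute (degree G) σ ⟩
    sum (degree G ∘ π)                                      ≡⟨ sum-cong-≗ degree∘π≡sum-A ⟩
    sum (λ i → sum (A i))                                   ≡⟨ sum-cong-≗ sum-A≡earlier+later ⟩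
    sum (λ i → sum (E i) + sum (λ j → E j i))               ≡⟨ ∑-distrib-+ (sum ∘ E) (λ i → sum (λ j → E j i)) ⟩
    sum (λ i → sum (E i)) + sum (λ i → sum (λ j → E j i))   ≡⟨ cong (sum (sum ∘ E) +_) (∑-comm (λ i j → E j i)) ⟩
    sum (λ i → sum (E i)) + sum (λ i → sum (E i))           ≡⟨ sym (cong₂ _+_ sum-backDegree sum-backDegree) ⟩
    sum backDegree + sum backDegree                         ∎
    where
    open ≡-Reasoning
    A E : Fin n → Fin n → ℕ
    A i j = boolToℕ (adj G (π i) (π j))
    E i j = boolToℕ (earlierNeighbour i j)
    degree∘π≡sum-A : ∀ i → degree G (π i) ≡ sum (A i)
    degree∘π≡sum-A i = trans (countTrue≡sum (adj G (π i))) (sum-permute (boolToℕ ∘ adj G (π i)) σ)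
    sum-A≡earlier+later : ∀ i → sum (A i) ≡ sum (E i) + sum (λ j → E j i)
    sum-A≡earlier+later i = trans (sum-cong-≗ (adj≡earlier+later i)) (∑-distrib-+ (E i) (λ j → E j i))
    sum-backDegree : sum backDegree ≡ sum (sum ∘ E)
    sum-backDegree = sum-cong-≗ (countTrue≡sum ∘ earlierNeighbour)

degenerate⇒sum-degree≤ : ∀ {n D} (G : Graph n) → Degenerate D G → sum (degree G) ≤ n * (2 * D)
degenerate⇒sum-degree≤ {n} {D} G (σ , backDegree≤D) = begin
  sum (degree G)                                ≡⟨ sum-degree≡sum-backDegree+sum-backDegree G σ ⟩
  sum (backDegree G σ) + sum (backDegree G σ)   ≤⟨ +-mono-≤ (sum≤n*c backDegree≤D) (sum≤n*c backDegree≤D) ⟩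
  n * D + n * D                                 ≡⟨ n*D+n*D≡n*[2*D] n D ⟩
  n * (2 * D)                                   ∎
  where
  open ≤-Reasoning
  n*D+n*D≡n*[2*D] : ∀ n D → n * D + n * D ≡ n * (2 * D)
  n*D+n*D≡n*[2*D] = solve-∀

[1+K]*[x>K]≤x : ∀ K x → suc K * boolToℕ (not (x ≤ᵇ K)) ≤ x
[1+K]*[x>K]≤x K x with x ≤ᵇ K in x≤K
... | true  = ≤-trans (≤-reflexive (*-zeroʳ (suc K))) z≤n
... | false = ≤-trans (≤-reflexive (*-identityʳ (suc K))) (≰⇒> (subst T x≤K ∘ ≤⇒≤ᵇ))

sum≤n*K⇒n≤[1+K]*count≤K : ∀ {n} (f : Fin n → ℕ) K → sum f ≤ n * K →
                           n ≤ suc K * countTrue (λ v → f v ≤ᵇ K)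
sum≤n*K⇒n≤[1+K]*count≤K {n} f K sum≤n*K = +-cancelˡ-≤ (n * K) n (suc K * L) (begin
  n * K + n                ≡⟨ +-comm (n * K) n ⟩
  n + n * K                ≡⟨ *-suc n K ⟨
  n * suc K                ≡⟨ *-comm n (suc K) ⟩
  suc K * n                ≡⟨ cong (suc K *_) (countTrue-not+countTrue small) ⟨
  suc K * (H + L)          ≡⟨ *-distribˡ-+ (suc K) H L ⟩
  suc K * H + suc K * L    ≤⟨ +-mono-≤ [1+K]*H≤sum ≤-refl ⟩
  sum f + suc K * L        ≤⟨ +-mono-≤ sum≤n*K ≤-refl ⟩
  n * K + suc K * L        ∎)
  where
  open ≤-Reasoning
  small : Fin n → Bool
  small v = f v ≤ᵇ K
  H L : ℕ
  H = countTrue (not ∘ small)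
  L = countTrue small
  [1+K]*H≤sum : suc K * H ≤ sum f
  [1+K]*H≤sum = begin
    suc K * H                                   ≡⟨ cong (suc K *_) (countTrue≡sum (not ∘ small)) ⟩
    suc K * sum (boolToℕ ∘ not ∘ small)         ≡⟨ *-distribˡ-sum (suc K) (boolToℕ ∘ not ∘ small) ⟩
    sum (λ v → suc K * boolToℕ (not (small v))) ≤⟨ sum-mono-≤ (λ v → [1+K]*[x>K]≤x K (f v)) ⟩
    sum f                                       ∎

≤ᵇ0⇒≡ᵇ0 : ∀ x → T (x ≤ᵇ 0) → T (x ≡ᵇ 0)
≤ᵇ0⇒≡ᵇ0 zero _ = _

≤ᵇ1+K⇒≤ᵇK∨≡ᵇ1+K : ∀ x K → T (x ≤ᵇ suc K) → T ((x ≤ᵇ K) ∨ (x ≡ᵇ suc K))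
≤ᵇ1+K⇒≤ᵇK∨≡ᵇ1+K x K x≤1+K with m≤n⇒m<n∨m≡n (≤ᵇ⇒≤ x (suc K) x≤1+K)
... | inj₁ x<1+K = from T-∨ (inj₁ (≤⇒≤ᵇ (m<1+n⇒m≤n x<1+K)))
... | inj₂ x≡1+K = from T-∨ (inj₂ (≡⇒≡ᵇ x (suc K) x≡1+K))

pigeonhole : ∀ {n} (f : Fin n → ℕ) K →
             Σ ℕ λ d → d ≤ K × countTrue (λ v → f v ≤ᵇ K) ≤ suc K * countTrue (λ v → f v ≡ᵇ d)
pigeonhole f zero = zero , z≤n , ≤-trans (countTrue-mono (≤ᵇ0⇒≡ᵇ0 ∘ f)) (≤-reflexive (sym (*-identityˡ _)))
pigeonhole f (suc K) with pigeonhole f K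
... | d , d≤K , count≤K≤ = [ (λ d≤1+K → suc K , ≤-refl , count≤1+K≤ (suc K) d≤1+K ≤-refl)
                          , (λ 1+K≤d → d , m≤n⇒m≤1+n d≤K , count≤1+K≤ d ≤-refl 1+K≤d)
                          ] (≤-total (count= d) (count= (suc K)))
  where
  open ≤-Reasoning
  count= : ℕ → ℕ
  count= e = countTrue (λ v → f v ≡ᵇ e)
  count≤1+K≤ : ∀ e → count= d ≤ count= e → count= (suc K) ≤ count= e →
               countTrue (λ v → f v ≤ᵇ suc K) ≤ suc (suc K) * count= e
  count≤1+K≤ e d≤e 1+K≤e = begin
    countTrue (λ v → f v ≤ᵇ suc K)                       ≤⟨ countTrue-mono (λ v → ≤ᵇ1+K⇒≤ᵇK∨≡ᵇ1+K (f v) K) ⟩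
    countTrue (λ v → (f v ≤ᵇ K) ∨ (f v ≡ᵇ suc K))         ≤⟨ countTrue-∨ (λ v → f v ≤ᵇ K) (λ v → f v ≡ᵇ suc K) ⟩
    countTrue (λ v → f v ≤ᵇ K) + count= (suc K)          ≤⟨ +-mono-≤ (≤-trans count≤K≤ (*-monoʳ-≤ (suc K) d≤e)) 1+K≤e ⟩
    suc K * count= e + count= e                          ≡⟨ +-comm (suc K * count= e) (count= e) ⟩
    suc (suc K) * count= e                               ∎

T-not⇒¬T : ∀ {b} → T (not b) → ¬ T b
T-not⇒¬T {true} ()

IsIndependent : ∀ {n} → Graph n → (Fin n → Bool) → Set
IsIndependent G I = ∀ u v → T (I u) → T (I v) → adj G u v ≡ false

LargeIndependentSubset : ∀ {n} → Graph n → ℕ → (Fin n → Bool) → Set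
LargeIndependentSubset {n} G m C =
  Σ (Fin n → Bool) λ I → I ⊆ C × IsIndependent G I × countTrue C ≤ suc m * countTrue I

T-does-≟⇒≡ : ∀ {n} (i v : Fin n) → T (does (i ≟ v)) → i ≡ v
T-does-≟⇒≡ i v i=v with i ≟ v
... | yes i≡v = i≡v

T⇒T[a∧not-b∨b] : ∀ a b → T a → T ((a ∧ not b) ∨ b)
T⇒T[a∧not-b∨b] true true  _ = _
T⇒T[a∧not-b∨b] true false _ = _

closedNeighbourhood : ∀ {n} → Graph n → Fin n → Fin n → Bool
closedNeighbourhood G v i = adj G v i ∨ does (i ≟ v)

countTrue-closedNeighbourhood : ∀ {n} (G : Graph n) v → countTrue (closedNeighbourhood G v) ≡ suc (degree G v)
countTrue-closedNeighbourhood G v = countTrue-insert (adj G v) v (subst T (irrefl G v))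

module RemoveClosedNeighbourhood {n} (G : Graph n) (C : Fin n → Bool) (v : Fin n) (v∈C : T (C v)) where

  N : Fin n → Bool
  N = closedNeighbourhood G v

  rest : Fin n → Bool
  rest i = C i ∧ not (N i)

  rest⊆C : rest ⊆ C
  rest⊆C i = proj₁ ∘ to T-∧

  rest∌N : ∀ i → T (rest i) → ¬ T (N i)
  rest∌N i = T-not⇒¬T ∘ proj₂ ∘ to T-∧

  v∉rest : ¬ T (rest v)
  v∉rest v∈rest = rest∌N v v∈rest (from T-∨ (inj₂ (from T-≡ (dec-true (v ≟ v) refl))))

  insert-v⊆C : ∀ {J : Fin n → Bool} → J ⊆ rest → (λ i → J i ∨ does (i ≟ v)) ⊆ C
  insert-v⊆C J⊆rest i =
    [ rest⊆C i ∘ J⊆rest i , (λ i=v → subst (T ∘ C) (sym (T-does-≟⇒≡ i v i=v)) v∈C) ] ∘ to T-∨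

  countTrue-rest< : countTrue rest < countTrue C
  countTrue-rest< = ≤-trans (≤-reflexive (sym (countTrue-insert rest v v∉rest)))
                            (countTrue-mono (insert-v⊆C (λ _ → id)))

  extend : ∀ {m} → degree G v ≤ m → LargeIndependentSubset G m rest → LargeIndependentSubset G m C
  extend {m} deg≤m (J , J⊆rest , J-independent , rest≤) = I , insert-v⊆C J⊆rest , I-independent , C≤
    where
    open ≤-Reasoning
    I : Fin n → Bool
    I i = J i ∨ does (i ≟ v)
    v∉J : ¬ T (J v)
    v∉J = v∉rest ∘ J⊆rest v
    ¬adj : ∀ i → T (J i) → adj G v i ≡ false
    ¬adj i i∈J = ¬-not (λ vi → rest∌N i (J⊆rest i i∈J) (from T-∨ (inj₁ (from T-≡ vi))))
    I-independent : IsIndependent G I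
    I-independent u w u∈I w∈I with to T-∨ u∈I | to T-∨ w∈I
    ... | inj₁ u∈J | inj₁ w∈J = J-independent u w u∈J w∈J
    ... | inj₁ u∈J | inj₂ w=v with refl ← T-does-≟⇒≡ w v w=v = trans (Graph.sym G u v) (¬adj u u∈J)
    ... | inj₂ u=v | inj₁ w∈J with refl ← T-does-≟⇒≡ u v u=v = ¬adj w w∈J
    ... | inj₂ u=v | inj₂ w=v with refl ← T-does-≟⇒≡ u v u=v | refl ← T-does-≟⇒≡ w v w=v =
      irrefl G v
    N≤1+m : countTrue N ≤ suc m
    N≤1+m = ≤-trans (≤-reflexive (countTrue-closedNeighbourhood G v)) (s≤s deg≤m)
    C≤ : countTrue C ≤ suc m * countTrue I
    C≤ = begin
      countTrue C                      ≤⟨ countTrue-mono (λ i → T⇒T[a∧not-b∨b] (C i) (N i)) ⟩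
      countTrue (λ i → rest i ∨ N i)   ≤⟨ countTrue-∨ rest N ⟩
      countTrue rest + countTrue N     ≤⟨ +-mono-≤ rest≤ N≤1+m ⟩
      suc m * countTrue J + suc m      ≡⟨ +-comm (suc m * countTrue J) (suc m) ⟩
      suc m + suc m * countTrue J      ≡⟨ *-suc (suc m) (countTrue J) ⟨
      suc m * suc (countTrue J)        ≡⟨ cong (suc m *_) (countTrue-insert J v v∉J) ⟨
      suc m * countTrue I              ∎

bounded-degree⇒LargeIndependentSubset : ∀ {n} (G : Graph n) m (C : Fin n → Bool) →
  (∀ v → T (C v) → degree G v ≤ m) → LargeIndependentSubset G m C
bounded-degree⇒LargeIndependentSubset G m C deg≤m = go C deg≤m (<-wellFounded (countTrue C))
  where
  go : ∀ C → (∀ v → T (C v) → degree G v ≤ m) → Acc _<_ (countTrue C) → LargeIndependentSubset G m C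
  go C deg≤m (acc smaller) with any? (T? ∘ C)
  ... | no C=∅ = (λ _ → false) , (λ _ ()) , (λ _ _ ()) ,
                 ≤-trans (≤-reflexive (countTrue-none C (λ v v∈C → C=∅ (v , v∈C)))) z≤n
  ... | yes (v , v∈C) = extend (deg≤m v v∈C) (go rest (λ u → deg≤m u ∘ rest⊆C u) (smaller countTrue-rest<))
    where open RemoveClosedNeighbourhood G C v v∈C

s*[s*[s*c]]≡s^3*c : ∀ s c → s * (s * (s * c)) ≡ s ^ 3 * c
s*[s*[s*c]]≡s^3*c s c = sym (begin
  s * (s * (s * 1)) * c    ≡⟨ *-assoc s (s * (s * 1)) c ⟩
  s * (s * (s * 1) * c)    ≡⟨ cong (s *_) (*-assoc s (s * 1) c) ⟩
  s * (s * (s * 1 * c))    ≡⟨ cong (λ t → s * (s * t)) (*-assoc s 1 c) ⟩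
  s * (s * (s * (1 * c)))  ≡⟨ cong (λ t → s * (s * (s * t))) (*-identityˡ c) ⟩
  s * (s * (s * c))        ∎)
  where open ≡-Reasoning

lemma2p5 : (n D : ℕ) (G : Graph n) → Degenerate D G →
    Σ ℕ λ d → d ≤ 2 * D × Σ (Subset n) λ I →
      n ≤ (2 * D + 1) ^ 3 * ∣ I ∣ × Independent G I × (∀ v → v ∈ I → degree G v ≡ d)
lemma2p5 n D G degenerate
  with d , d≤2D , small≤ ← pigeonhole (degree G) (2 * D)
  with I , I⊆C , I-independent , C≤ ← bounded-degree⇒LargeIndependentSubset G (2 * D) (λ v → degree G v ≡ᵇ d)
                                         (λ v v∈C → subst (_≤ 2 * D) (sym (≡ᵇ⇒≡ (degree G v) d v∈C)) d≤2D)
  = d , d≤2D , tabulate I , n≤ ,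
    (λ u v u∈I v∈I → I-independent u v (∈tabulate⇒T I u∈I) (∈tabulate⇒T I v∈I)) ,
    (λ v v∈I → ≡ᵇ⇒≡ (degree G v) d (I⊆C v (∈tabulate⇒T I v∈I)))
  where
  open ≤-Reasoning
  s : ℕ
  s = suc (2 * D)
  n≤ : n ≤ (2 * D + 1) ^ 3 * ∣ tabulate I ∣
  n≤ = begin
    n                                            ≤⟨ sum≤n*K⇒n≤[1+K]*count≤K (degree G) (2 * D) (degenerate⇒sum-degree≤ G degenerate) ⟩
    s * countTrue (λ v → degree G v ≤ᵇ 2 * D)    ≤⟨ *-monoʳ-≤ s small≤ ⟩
    s * (s * countTrue (λ v → degree G v ≡ᵇ d))  ≤⟨ *-monoʳ-≤ s (*-monoʳ-≤ s C≤) ⟩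
    s * (s * (s * countTrue I))                  ≡⟨ s*[s*[s*c]]≡s^3*c s (countTrue I) ⟩
    s ^ 3 * countTrue I                          ≡⟨ cong₂ (λ t c → t ^ 3 * c) (+-comm 1 (2 * D)) (sym (∣tabulate∣≡countTrue I)) ⟩
    (2 * D + 1) ^ 3 * ∣ tabulate I ∣             ∎
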